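{- Let $s,m$ be positive integers and let $S\subseteq\mathcal L_m(s)$ be a generalized-$\beta$-set with $t=t(S)$. Then: (1) $A_i-A_{i+1}\ge 2m$ for $1\le i\le t-2$; (2) if $t\ge2$ and $A_{t-1}-A_t\le 2m-1$, then there exists $1\le p<m$ such that $a_{(t-1)m}=a_{(t-1)m+1}=\dots=a_{(t-1)m+p}=1$ and $a_{(t-1)m+p+1}=\dots=a_{tm}=0$.
   Context: Let $N=\lceil (s-1)/2\rceil m$. Define $\mathcal L_m(s)=\bigcup_{k=1}^mP_k$ with $P_k=\{\,i\,ms+j: i\ge0,\ (k-1)s+1+i\le j\le ks-1-i\,\}$ for $1\le k\le m-1$ and $P_m=\{\,i\,ms+j: i\ge0,\ (m-1)s+1+i\le j\le ms-2-i\,\}$. For a nonempty set $S\subseteq\{1,\dots,Ns-1\}$ let $t=t(S)=\min\{i\ge1: S\subseteq[0,ims-1]\}$, and for $1\le i\le N$ let $\mathcal B_i=S\cap[(i-1)s,is-1]$, $a_i=|\mathcal B_i|$, and $n_i=\max\{x\bmod s: x\in\mathcal B_i\}$ ($n_i=0$ if $\mathcal B_i=\emptyset$); for $1\le k\le\lceil (s-1)/2\rceil$ let $A_k=\sum_{j=1}^m a_{(k-1)m+j}$. A nonempty set $S\subseteq\mathcal L_m(s)$ is a generalized-$\beta$-set if: (1) for $1\le i<N$, $a_i=0$ implies $a_{i+1}=0$; (2) for $1\le i<tm$ with $m\nmid i$, $a_i\ge a_{i+1}$; (3) for $1\le i\le (t-1)m$ with $a_{i+m}>0$, $a_{i+m}\le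 a_i-2$; (4) for $1\le i<tm$ with $m\nmid i$ and $a_{i+1}>0$, $n_i\ge n_{i+1}$; (5) for $1\le i<tm$ with $m\nmid i$ and $a_i=a_{i+1}>0$, $n_i=n_{i+1}$; (6) if $t\ge2$, $a_{(t-1)m}\ge a_{(t-1)m+1}$. -}

module Defs where

open import Data.Nat.Base
open import Data.Nat.Divisibility using (_∣_)
open import Data.Bool.Base using (Bool; true; false; if_then_else_)
open import Data.Product using (Σ; ∃; _×_; _,_)
open import Relation.Binary.PropositionalEquality using (_≡_)
open import Relation.Nullary using (¬_)

_∈S_ : ℕ → (ℕ → Bool) → Set
x ∈S S = S x ≡ true

bigN : (m s : ℕ) → ℕ
bigN m s = ⌈ s ∸ 1 /2⌉ * m

-- Membership in P_k (1 ≤ k ≤ m), elements i·m·s + j with the stated bounds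
-- (upper bound j ≤ ks-1-i written as j + i + 1 ≤ ks, resp. j ≤ ms-2-i as j + i + 2 ≤ ms).
InP : (m s k x : ℕ) → Set
InP m s k x = Σ ℕ λ i → Σ ℕ λ j → (x ≡ i * m * s + j) ×
  ((k < m → ((k ∸ 1) * s + 1 + i ≤ j) × (j + i + 1 ≤ k * s)) ×
   (k ≡ m → ((m ∸ 1) * s + 1 + i ≤ j) × (j + i + 2 ≤ m * s)))

InL : (m s x : ℕ) → Set
InL m s x = Σ ℕ λ k → (1 ≤ k) × (k ≤ m) × InP m s k x

count : (ℕ → Bool) → (lo len : ℕ) → ℕ
count S lo zero = 0
count S lo (suc n) = (if S lo then 1 else 0) + count S (suc lo) n

maxMod : (s : ℕ) .{{_ : NonZero s}} → (ℕ → Bool) → (lo len : ℕ) → ℕ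
maxMod s S lo zero = 0
maxMod s S lo (suc n) = (if S lo then lo % s else 0) ⊔ maxMod s S (suc lo) n

aᵢ : (s : ℕ) → (ℕ → Bool) → ℕ → ℕ
aᵢ s S i = count S ((i ∸ 1) * s) s

nᵢ : (s : ℕ) .{{_ : NonZero s}} → (ℕ → Bool) → ℕ → ℕ
nᵢ s S i = maxMod s S ((i ∸ 1) * s) s

sum1 : (ℕ → ℕ) → ℕ → ℕ
sum1 f zero = 0
sum1 f (suc n) = sum1 f n + f (suc n)

Aₖ : (m s : ℕ) → (ℕ → Bool) → ℕ → ℕ
Aₖ m s S k = sum1 (λ j → aᵢ s S ((k ∸ 1) * m + j)) m

SubsetBelow : (ℕ → Bool) → ℕ → Set
SubsetBelow S b = ∀ x → x ∈S S → x < b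

IsT : (m s : ℕ) → (ℕ → Bool) → ℕ → Set
IsT m s S t = (1 ≤ t) × SubsetBelow S (t * m * s) ×
  (∀ i → 1 ≤ i → i < t → ¬ SubsetBelow S (i * m * s))

-- conditions (1)–(6) for a given t
BetaConds : (m s : ℕ) .{{_ : NonZero s}} → (ℕ → Bool) → ℕ → Set
BetaConds m s S t =
  (∀ i → 1 ≤ i → i < bigN m s → a i ≡ 0 → a (suc i) ≡ 0) ×
  (∀ i → 1 ≤ i → i < t * m → ¬ (m ∣ i) → a (suc i) ≤ a i) ×
  (∀ i → 1 ≤ i → i ≤ (t ∸ 1) * m → 0 < a (i + m) → a (i + m) + 2 ≤ a i) ×
  (∀ i → 1 ≤ i → i < t * m → ¬ (m ∣ i) → 0 < a (suc i) → n (suc i) ≤ n i) ×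
  (∀ i → 1 ≤ i → i < t * m → ¬ (m ∣ i) → a i ≡ a (suc i) → 0 < a (suc i) → n i ≡ n (suc i)) ×
  (2 ≤ t → a ((t ∸ 1) * m + 1) ≤ a ((t ∸ 1) * m))
  where
  a = aᵢ s S
  n = nᵢ s S

IsGenBeta : (m s : ℕ) .{{_ : NonZero s}} → (ℕ → Bool) → Set
IsGenBeta m s S =
  (∃ λ x → x ∈S S) ×
  (∀ x → x ∈S S → (1 ≤ x) × (x ≤ bigN m s * s ∸ 1)) ×
  (∀ x → x ∈S S → InL m s x) ×
  (∀ t → IsT m s S t → BetaConds m s S t)

-- By condition (1), an empty block is followed only by empty blocks; minimality of t
-- therefore makes the blocks 1, …, (t-1)m + 1 nonempty.  Condition (3) then puts each
-- of them at least 2 below the block m places earlier, and summing over a row gives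
-- A_i - A_{i+1} ≥ 2m.  In the last row the same sum shows that A_{t-1} - A_t < 2m forces
-- a_{(t-1)m} = 1 (rows are antitone by (2)); then (6) gives a_{(t-1)m+1} = 1, (3) gives
-- a_{tm} = 0, and an antitone sequence from 1 down to 0 is a single step.
module Submission where

open import Defs
open import Data.Nat.Base
open import Data.Nat.Properties
open import Data.Nat.DivMod using (_/_; m≡m%n+[m/n]*n; m%n<n; m/n*n≤m; m<n*o⇒m/o<n)
open import Data.Nat.Divisibility using (_∣_; ∣m+n∣m⇒∣n; n∣m*n; ∣⇒≤)
open import Data.Nat.Tactic.RingSolver using (solve-∀)
open import Data.Bool.Base using (Bool; if_then_else_)
open import Data.Product using (Σ; _×_; _,_; proj₁; proj₂)
open import Function using (_∘_)
open import Relation.Binary.PropositionalEquality using (_≡_; refl; sym; trans; cong; subst)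
open import Relation.Nullary using (¬_; yes; no; contradiction)

interval-induction : (P : ℕ → Set) {i hi : ℕ} → P i →
  (∀ j → i ≤ j → j < hi → P j → P (suc j)) → ∀ {j} → i ≤ j → j ≤ hi → P j
interval-induction P {i} {hi} Pi step i≤j = go (≤⇒≤′ i≤j)
  where
  go : ∀ {j} → i ≤′ j → j ≤ hi → P j
  go ≤′-refl _ = Pi
  go (≤′-step {n} i≤′n) 1+n≤hi = step n (≤′⇒≤ i≤′n) 1+n≤hi (go i≤′n (≤-trans (n≤1+n n) 1+n≤hi))

antitone-on : (f : ℕ → ℕ) {lo hi : ℕ} → (∀ j → lo ≤ j → j < hi → f (suc j) ≤ f j) →
  ∀ {i j} → lo ≤ i → i ≤ j → j ≤ hi → f j ≤ f i
antitone-on f mono {i} lo≤i = interval-induction (λ j → f j ≤ f i) ≤-refl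
  (λ j i≤j j<hi fj≤fi → ≤-trans (mono j (≤-trans lo≤i i≤j) j<hi) fj≤fi)

antitone-1→0-step : (f : ℕ → ℕ) (n : ℕ) → (∀ j → j < n → f (suc j) ≤ f j) → f 0 ≡ 1 → f n ≡ 0 →
  Σ ℕ λ p → (p < n) × (∀ j → j ≤ p → f j ≡ 1) × (∀ j → p + 1 ≤ j → j ≤ n → f j ≡ 0)
antitone-1→0-step f zero _ f0≡1 f0≡0 = contradiction (trans (sym f0≡0) f0≡1) 0≢1+n
antitone-1→0-step f (suc n) mono f0≡1 fn≡0 with f 1 in f1≡
... | zero = 0 , z<s , ones , zeros
  where
  ones : ∀ j → j ≤ 0 → f j ≡ 1
  ones zero _ = f0≡1
  zeros : ∀ j → 1 ≤ j → j ≤ suc n → f j ≡ 0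
  zeros j 1≤j j≤1+n = n≤0⇒n≡0 (subst (f j ≤_) f1≡
    (antitone-on f (λ k _ k<1+n → mono k k<1+n) z≤n 1≤j j≤1+n))
... | suc _ with antitone-1→0-step (f ∘ suc) n (λ j j<n → mono (suc j) (s≤s j<n)) f1≡1 fn≡0
  where
  f1≡1 : f 1 ≡ 1
  f1≡1 = ≤-antisym (subst (f 1 ≤_) f0≡1 (mono 0 z<s)) (subst (1 ≤_) (sym f1≡) z<s)
...   | p , p<n , ones , zeros = suc p , s≤s p<n , ones′ , zeros′
  where
  ones′ : ∀ j → j ≤ suc p → f j ≡ 1
  ones′ zero _ = f0≡1
  ones′ (suc j) j≤p = ones j (≤-pred j≤p)
  zeros′ : ∀ j → suc p + 1 ≤ j → j ≤ suc n → f j ≡ 0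
  zeros′ (suc j) p+1≤j j≤n = zeros j (≤-pred p+1≤j) (≤-pred j≤n)

sum1-gap : ∀ (f g : ℕ → ℕ) d n → (∀ j → 1 ≤ j → j ≤ n → f j + d ≤ g j) →
  sum1 f n + d * n ≤ sum1 g n
sum1-gap f g d zero gap = ≤-reflexive (*-zeroʳ d)
sum1-gap f g d (suc n) gap = subst (_≤ sum1 g n + g (suc n)) (sym (regroup (sum1 f n) (f (suc n)) d n))
  (+-mono-≤ (sum1-gap f g d n (λ j 1≤j j≤n → gap j 1≤j (m≤n⇒m≤1+n j≤n))) (gap (suc n) z<s ≤-refl))
  where
  regroup : ∀ x y d n → x + y + d * suc n ≡ (x + d * n) + (y + d)
  regroup = solve-∀

∈⇒0<count : ∀ S lo len {x} → x ∈S S → lo ≤ x → x < lo + len → 0 < count S lo len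
∈⇒0<count S lo zero {x} _ lo≤x x<lo+0 = contradiction lo≤x (<⇒≱ (subst (x <_) (+-identityʳ lo) x<lo+0))
∈⇒0<count S lo (suc n) {x} x∈S lo≤x x<lo+1+n with lo ≟ x
... | yes refl rewrite x∈S = z<s
... | no lo≢x = ≤-trans (∈⇒0<count S (suc lo) n x∈S (≤∧≢⇒< lo≤x lo≢x) (subst (x <_) (+-suc lo n) x<lo+1+n))
                        (m≤n+m _ (if S lo then 1 else 0))

m<[1+m/n]*n : ∀ m n .{{_ : NonZero n}} → m < suc (m / n) * n
m<[1+m/n]*n m n = subst (_< n + m / n * n) (sym (m≡m%n+[m/n]*n m n)) (+-monoˡ-< (m / n * n) (m%n<n m n))

-- Blocks are numbered from 1: x lies in B_{x/s + 1}.
∈⇒0<aᵢ[1+x/s] : ∀ s .{{_ : NonZero s}} S {x} → x ∈S S → 0 < aᵢ s S (suc (x / s))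
∈⇒0<aᵢ[1+x/s] s S {x} x∈S = ∈⇒0<count S (x / s * s) s x∈S (m/n*n≤m x s)
  (subst (x <_) (+-comm s (x / s * s)) (m<[1+m/n]*n x s))

0<n⇒pred[n]<n : ∀ {n} → 0 < n → pred n < n
0<n⇒pred[n]<n {suc n} _ = n<1+n n

0<j<m⇒m∤k*m+j : ∀ k m j → 0 < j → j < m → ¬ (m ∣ k * m + j)
0<j<m⇒m∤k*m+j k m j@(suc _) _ j<m m∣km+j = <⇒≱ j<m (∣⇒≤ (∣m+n∣m⇒∣n m∣km+j (n∣m*n k)))

k*m+j≤[1+k]*m : ∀ k m j → j ≤ m → k * m + j ≤ suc k * m
k*m+j≤[1+k]*m k m j j≤m = subst (k * m + j ≤_) (+-comm (k * m) m) (+-monoʳ-≤ (k * m) j≤m)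

-- Rows are counted from 0: row k consists of the blocks k * m + j with 1 ≤ j ≤ m, so
-- A_{k+1} sums row k, and t = 2 + r makes row r + 1 the last one.
module GeneralizedBetaSet (s m : ℕ) .{{_ : NonZero s}} (1≤m : 1 ≤ m) (S : ℕ → Bool) (r : ℕ)
  (β : IsGenBeta m s S) (t-min : IsT m s S (2 + r)) where

  a : ℕ → ℕ
  a = aᵢ s S

  N : ℕ
  N = bigN m s

  private
    conds = proj₂ (proj₂ (proj₂ β)) (2 + r) t-min
    zero-stays-zero = proj₁ conds
    antitone-in-rows = proj₁ (proj₂ conds)
    gap-to-row-above = proj₁ (proj₂ (proj₂ conds))
    last-row-starts-below = proj₂ (proj₂ (proj₂ (proj₂ (proj₂ conds))))

  1+x/s≤N : ∀ {x} → x ∈S S → suc (x / s) ≤ N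
  1+x/s≤N x∈S with proj₁ (proj₂ β) _ x∈S
  ... | 0<x , x≤pred[Ns] = m<n*o⇒m/o<n
    (≤-<-trans x≤pred[Ns] (0<n⇒pred[n]<n (<-≤-trans 0<x (≤-trans x≤pred[Ns] pred[n]≤n))))

  a≡0-persists : ∀ {i j} → 1 ≤ i → a i ≡ 0 → i ≤ j → j ≤ N → a j ≡ 0
  a≡0-persists 1≤i ai≡0 = interval-induction (λ j → a j ≡ 0) ai≡0
    (λ j i≤j j<N → zero-stays-zero j (≤-trans 1≤i i≤j) j<N)

  0<a : ∀ {j} → 1 ≤ j → j ≤ suc (suc r * m) → 0 < a j
  0<a {j} 1≤j j≤ = n≢0⇒n>0 λ aj≡0 → proj₂ (proj₂ t-min) (suc r) z<s ≤-refl (below aj≡0)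
    where
    below : a j ≡ 0 → SubsetBelow S (suc r * m * s)
    below aj≡0 x x∈S = <-≤-trans (m<[1+m/n]*n x s) (*-monoˡ-≤ s (≤-pred (≤-trans 2+x/s≤j j≤)))
      where
      2+x/s≤j : suc (suc (x / s)) ≤ j
      2+x/s≤j = ≰⇒> λ j≤1+x/s →
        <⇒≢ (∈⇒0<aᵢ[1+x/s] s S x∈S) (sym (a≡0-persists 1≤j aj≡0 j≤1+x/s (1+x/s≤N x∈S)))

  row-antitone : ∀ k → k ≤ suc r → ∀ j → 1 ≤ j → j < m → a (k * m + suc j) ≤ a (k * m + j)
  row-antitone k k≤1+r j 1≤j j<m = subst (λ i → a i ≤ a (k * m + j)) (sym (+-suc (k * m) j))
    (antitone-in-rows (k * m + j) (≤-trans 1≤j (m≤n+m j (k * m)))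
      (<-≤-trans (+-monoʳ-< (k * m) j<m)
        (subst (_≤ (2 + r) * m) (+-comm m (k * m)) (*-monoˡ-≤ m (s≤s k≤1+r))))
      (0<j<m⇒m∤k*m+j k m j 1≤j j<m))

  row-gap : ∀ k j → 1 ≤ j → j ≤ m → k ≤ r → 0 < a (suc k * m + j) →
    a (suc k * m + j) + 2 ≤ a (k * m + j)
  row-gap k j 1≤j j≤m k≤r 0<a′ = subst (λ i → a i + 2 ≤ a (k * m + j)) (shift k m j)
    (gap-to-row-above (k * m + j) (≤-trans 1≤j (m≤n+m j (k * m)))
      (≤-trans (k*m+j≤[1+k]*m k m j j≤m) (*-monoˡ-≤ m (s≤s k≤r)))
      (subst (λ i → 0 < a i) (sym (shift k m j)) 0<a′))
    where
    shift : ∀ k m j → k * m + j + m ≡ suc k * m + j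
    shift = solve-∀

  A-gap : ∀ i → 1 ≤ i → i + 2 ≤ 2 + r → Aₖ m s S (suc i) + 2 * m ≤ Aₖ m s S i
  A-gap (suc k) _ i+2≤t = sum1-gap _ _ 2 m λ j 1≤j j≤m →
    row-gap k j 1≤j j≤m (≤-trans (n≤1+n k) (≤-pred 2+k≤1+r))
      (0<a (≤-trans 1≤j (m≤n+m j _))
        (≤-trans (k*m+j≤[1+k]*m (suc k) m j j≤m) (≤-trans (*-monoˡ-≤ m 2+k≤1+r) (n≤1+n _))))
    where
    2+k≤1+r : suc (suc k) ≤ suc r
    2+k≤1+r = ≤-pred (subst (_≤ 2 + r) (+-comm (suc k) 2) i+2≤t)

  last-row-antitone : ∀ j → j < m → a (suc r * m + suc j) ≤ a (suc r * m + j)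
  last-row-antitone zero _ = subst (λ i → a (suc r * m + 1) ≤ a i) (sym (+-identityʳ (suc r * m)))
    (last-row-starts-below (s≤s (s≤s z≤n)))
  last-row-antitone (suc j) j<m = row-antitone (suc r) ≤-refl (suc j) z<s j<m

  row-end : a (r * m + m) ≡ a (suc r * m)
  row-end = cong a (+-comm (r * m) m)

  module _ (A-small : Aₖ m s S (suc r) ≤ Aₖ m s S (2 + r) + (2 * m ∸ 1)) where

    -- Otherwise every block of the last row would be at least 2 below the one above it.
    a[row-end]≡1 : a (suc r * m) ≡ 1
    a[row-end]≡1 with a (suc r * m) ≤? 1
    ... | yes ≤1 = ≤-antisym ≤1 (0<a (≤-trans 1≤m (m≤m+n m _)) (n≤1+n _))
    ... | no ≰1 = contradiction (≤-trans (sum1-gap _ _ 2 m gap) A-small)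
                    (<⇒≱ (+-monoʳ-< (Aₖ m s S (2 + r)) (0<n⇒pred[n]<n 0<2m)))
      where
      0<2m : 0 < 2 * m
      0<2m = ≤-trans 1≤m (m≤m+n m _)
      gap : ∀ j → 1 ≤ j → j ≤ m → a (suc r * m + j) + 2 ≤ a (r * m + j)
      gap j 1≤j j≤m with a (suc r * m + j) in eq
      ... | zero = ≤-trans (≰⇒> ≰1) (subst (_≤ a (r * m + j)) row-end
              (antitone-on (λ i → a (r * m + i)) (row-antitone r (n≤1+n r)) 1≤j j≤m ≤-refl))
      ... | suc _ = subst (λ c → c + 2 ≤ a (r * m + j)) eq
              (row-gap r j 1≤j j≤m ≤-refl (subst (0 <_) (sym eq) z<s))

    a[last-row-end]≡0 : a (suc r * m + m) ≡ 0
    a[last-row-end]≡0 with a (suc r * m + m) in eq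
    ... | zero = refl
    ... | suc _ = contradiction
            (subst (2 ≤_) (trans row-end a[row-end]≡1) (≤-trans (m≤n+m 2 _) gap)) λ { (s≤s ()) }
      where
      gap : a (suc r * m + m) + 2 ≤ a (r * m + m)
      gap = row-gap r m 1≤m ≤-refl ≤-refl (subst (0 <_) (sym eq) z<s)

    last-row-step : Σ ℕ λ p → (1 ≤ p) × (p < m) ×
      (∀ j → j ≤ p → a (suc r * m + j) ≡ 1) × (∀ j → p + 1 ≤ j → j ≤ m → a (suc r * m + j) ≡ 0)
    last-row-step with antitone-1→0-step (λ j → a (suc r * m + j)) m last-row-antitone
                         (trans (cong a (+-identityʳ (suc r * m))) a[row-end]≡1) a[last-row-end]≡0
    ... | zero , _ , _ , zeros = contradiction (zeros 1 ≤-refl 1≤m)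
            (n>0⇒n≢0 (0<a (m≤n+m 1 _) (≤-reflexive (+-comm _ 1))))
    ... | suc p , p<m , ones , zeros = suc p , z<s , p<m , ones , zeros

proposition4p7 : (s m : ℕ) .{{_ : NonZero s}} → 1 ≤ m → (S : ℕ → Bool) → (t : ℕ) →
    IsGenBeta m s S → IsT m s S t →
    (∀ i → 1 ≤ i → i + 2 ≤ t → Aₖ m s S (suc i) + 2 * m ≤ Aₖ m s S i) ×
    (2 ≤ t → Aₖ m s S (t ∸ 1) ≤ Aₖ m s S t + (2 * m ∸ 1) →
      Σ ℕ λ p → (1 ≤ p) × (p < m) ×
        (∀ j → j ≤ p → aᵢ s S ((t ∸ 1) * m + j) ≡ 1) ×
        (∀ j → p + 1 ≤ j → j ≤ m → aᵢ s S ((t ∸ 1) * m + j) ≡ 0))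
proposition4p7 s m 1≤m S zero β t-min = contradiction (proj₁ t-min) λ ()
proposition4p7 s m 1≤m S (suc zero) β t-min =
  (λ i _ i+2≤1 → contradiction (≤-trans (m≤n+m 2 i) i+2≤1) λ { (s≤s ()) }) , λ { (s≤s ()) }
proposition4p7 s m 1≤m S (suc (suc r)) β t-min =
  A-gap , λ _ A-small → last-row-step A-small
  where open GeneralizedBetaSet s m 1≤m S r β t-min
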